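{- Every $\mathrm{PTL}$ formula has a provably equivalent (in $\mathsf{H}^0\mathsf{L}\mathsf{S}$) formula of $\mathcal{S}^+(\mathrm{PL}\cup\{\textsc{ne}\})$.
   Context: Fix a countably infinite set $\mathrm{PS}$ of propositional variables; $\mathrm{PL}$ formulas are built from $\mathrm{PS}$ with $\neg,\to$ ($\top:=\alpha\to\alpha$, $\bot:=\neg\top$, $\lor,\land$ usual). $\mathrm{PTL}$ formulas: closure of $\mathrm{PL}$ under $\sim$, $\rightarrowtail$ (material implication), $\multimap$ (linear implication). Abbreviations: $\varphi\otimes\psi:=\sim(\varphi\multimap\sim\psi)$, $\varphi\sqcap\psi:=\sim(\varphi\rightarrowtail\sim\psi)$, $\varphi\sqcup\psi:=\sim\varphi\rightarrowtail\psi$, $\varphi\bowtie\psi:=(\varphi\rightarrowtail\psi)\sqcap(\psi\rightarrowtail\varphi)$, $\textsc{ne}:=\sim\bot$. $\mathcal{S}^+(\mathrm{PL}\cup\{\textsc{ne}\})$ is the closure of $\mathrm{PL}\cup\{\textsc{ne}\}$ under $\sqcap,\sqcup,\otimes$ only. Two formulas $\varphi,\psi$ are provably equivalent if $\{\varphi\}\vdash\psi$ and $\{\psi\}\vdash\varphi$. Derivations: $\Phi\vdash\varphi$ means a finite sequence ending in $\varphi$ of formulas each in $\Phi$, an axiom instance, or obtained by a rule from earlier ones; "theorem only" rules apply only to formulas derivable without premises. $\mathsf{H}^0\mathsf{L}\mathsf{S}$ ($\alpha,\beta,\gamma$ classical, $\varphi,\psi,\vartheta$ arbitrary): $\alpha\to(\beta\to\alpha)$;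 $(\alpha\to(\beta\to\gamma))\to((\alpha\to\beta)\to(\alpha\to\gamma))$; $(\neg\alpha\to\neg\beta)\to(\beta\to\alpha)$; from $\alpha,\alpha\to\beta$ infer $\beta$; $\varphi\rightarrowtail(\psi\rightarrowtail\varphi)$; $(\varphi\rightarrowtail(\psi\rightarrowtail\vartheta))\rightarrowtail((\varphi\rightarrowtail\psi)\rightarrowtail(\varphi\rightarrowtail\vartheta))$; $(\sim\varphi\rightarrowtail\sim\psi)\rightarrowtail(\psi\rightarrowtail\varphi)$; $(\alpha\to\beta)\rightarrowtail(\alpha\rightarrowtail\beta)$; from $\varphi,\varphi\rightarrowtail\psi$ infer $\psi$; $(\alpha\otimes\beta)\bowtie(\alpha\lor\beta)$; $\alpha\rightarrowtail(\varphi\multimap\alpha)$; $\varphi\rightarrowtail((\varphi\multimap\psi)\rightarrowtail(\vartheta\multimap\psi))$; $(\varphi\multimap(\psi\multimap\vartheta))\rightarrowtail(\psi\multimap(\varphi\multimap\vartheta))$; $(\varphi\multimap\sim\psi)\rightarrowtail(\psi\multimap\sim\varphi)$; $(\varphi\multimap(\psi\rightarrowtail\vartheta))\rightarrowtail((\varphi\multimap\psi)\rightarrowtail(\varphi\multimap\vartheta))$; theorem-only rule: from $\varphi$ infer $\psi\multimap\varphi$. -}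

module Defs where

open import Data.Nat using (ℕ)
open import Relation.Binary.PropositionalEquality using (_≡_)

PS : Set
PS = ℕ

data PL : Set where
  var  : PS → PL
  ¬_   : PL → PL
  _⇒_  : PL → PL → PL

infixr 5 _⇒_
infix 7 ¬_

⊤ᶜ : PL
⊤ᶜ = var 0 ⇒ var 0

⊥ᶜ : PL
⊥ᶜ = ¬ ⊤ᶜ

_∨_ : PL → PL → PL
α ∨ β = (¬ α) ⇒ β

_∧_ : PL → PL → PL
α ∧ β = ¬ (α ⇒ ¬ β)

-- PTL formulas: closure of PL under ∼, ↣ (material), ⊸ (linear implication).
data PTL : Set where
  cl   : PL → PTL
  ∼_   : PTL → PTL
  _↣_  : PTL → PTL → PTL
  _⊸_  : PTL → PTL → PTL

infixr 4 _↣_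
infixr 4 _⊸_
infix 6 ∼_

_⊗_ : PTL → PTL → PTL
φ ⊗ ψ = ∼ (φ ⊸ ∼ ψ)

_⊓_ : PTL → PTL → PTL
φ ⊓ ψ = ∼ (φ ↣ ∼ ψ)

_⊔_ : PTL → PTL → PTL
φ ⊔ ψ = (∼ φ) ↣ ψ

_⋈_ : PTL → PTL → PTL
φ ⋈ ψ = (φ ↣ ψ) ⊓ (ψ ↣ φ)

NE : PTL
NE = ∼ (cl ⊥ᶜ)

Empty : PTL → Set
Empty _ = Data.Empty.⊥
  where import Data.Empty

Single : PTL → PTL → Set
Single φ χ = χ ≡ φ

-- The Hilbert system H⁰LS.  Φ ⊢ φ : φ is derivable from Φ.
-- (Inductive derivation trees; equivalent to finite derivation sequences.)
-- α β γ range over classical formulas, φ ψ ϑ over arbitrary PTL formulas.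
data _⊢_ : (PTL → Set) → PTL → Set₁ where
  hyp  : ∀ {Φ φ} → Φ φ → Φ ⊢ φ
  C1   : ∀ {Φ} (α β : PL) → Φ ⊢ cl (α ⇒ (β ⇒ α))
  C2   : ∀ {Φ} (α β γ : PL) →
         Φ ⊢ cl ((α ⇒ (β ⇒ γ)) ⇒ ((α ⇒ β) ⇒ (α ⇒ γ)))
  C3   : ∀ {Φ} (α β : PL) → Φ ⊢ cl (((¬ α) ⇒ (¬ β)) ⇒ (β ⇒ α))
  MPc  : ∀ {Φ} {α β : PL} → Φ ⊢ cl α → Φ ⊢ cl (α ⇒ β) → Φ ⊢ cl β
  M1   : ∀ {Φ} (φ ψ : PTL) → Φ ⊢ (φ ↣ (ψ ↣ φ))
  M2   : ∀ {Φ} (φ ψ ϑ : PTL) →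
         Φ ⊢ ((φ ↣ (ψ ↣ ϑ)) ↣ ((φ ↣ ψ) ↣ (φ ↣ ϑ)))
  M3   : ∀ {Φ} (φ ψ : PTL) → Φ ⊢ (((∼ φ) ↣ (∼ ψ)) ↣ (ψ ↣ φ))
  M4   : ∀ {Φ} (α β : PL) → Φ ⊢ (cl (α ⇒ β) ↣ (cl α ↣ cl β))
  MPm  : ∀ {Φ φ ψ} → Φ ⊢ φ → Φ ⊢ (φ ↣ ψ) → Φ ⊢ ψ
  T1   : ∀ {Φ} (α β : PL) → Φ ⊢ ((cl α ⊗ cl β) ⋈ cl (α ∨ β))
  L1   : ∀ {Φ} (α : PL) (φ : PTL) → Φ ⊢ (cl α ↣ (φ ⊸ cl α))
  L2   : ∀ {Φ} (φ ψ ϑ : PTL) → Φ ⊢ (φ ↣ ((φ ⊸ ψ) ↣ (ϑ ⊸ ψ)))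
  L3   : ∀ {Φ} (φ ψ ϑ : PTL) →
         Φ ⊢ ((φ ⊸ (ψ ⊸ ϑ)) ↣ (ψ ⊸ (φ ⊸ ϑ)))
  L4   : ∀ {Φ} (φ ψ : PTL) → Φ ⊢ ((φ ⊸ ∼ ψ) ↣ (ψ ⊸ ∼ φ))
  L5   : ∀ {Φ} (φ ψ ϑ : PTL) →
         Φ ⊢ ((φ ⊸ (ψ ↣ ϑ)) ↣ ((φ ⊸ ψ) ↣ (φ ⊸ ϑ)))
  Nec  : ∀ {Φ φ} (ψ : PTL) → Empty ⊢ φ → Φ ⊢ (ψ ⊸ φ)

_≣_ : PTL → PTL → Set₁
φ ≣ ψ = (Single φ ⊢ ψ) Data.Product.× (Single ψ ⊢ φ)
  where import Data.Product

data S⁺ : PTL → Set where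
  s-cl : (α : PL) → S⁺ (cl α)
  s-ne : S⁺ NE
  s-⊓  : ∀ {φ ψ} → S⁺ φ → S⁺ ψ → S⁺ (φ ⊓ ψ)
  s-⊔  : ∀ {φ ψ} → S⁺ φ → S⁺ ψ → S⁺ (φ ⊔ ψ)
  s-⊗  : ∀ {φ ψ} → S⁺ φ → S⁺ ψ → S⁺ (φ ⊗ ψ)

module Submission where

-- The proof goes through a disjunctive normal form.  A *basic* formula is
-- α ⊓ ∼β₁ ⊓ … ⊓ ∼βₖ with α, βᵢ classical, and a *DNF* is a ⊔-disjunction of
-- basic formulas (the empty disjunction being the contradiction ∼⊤).
-- We show that DNFs are closed, up to provable equivalence, under ∼, ⊔, ⊓
-- and ⊗; since φ ↣ ψ ≡ ∼φ ⊔ ψ and φ ⊸ ψ ≡ ∼(φ ⊗ ∼ψ), every PTL formula has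
-- an equivalent DNF.  Finally the one atom outside S⁺, namely ∼β, is
-- equivalent to (¬β ⊓ NE) ⊗ ⊤ ("some nonempty part of the team falsifies β"),
-- which lies in S⁺; replacing each ∼β by it turns a DNF into an S⁺ formula.

open import Defs
open import Data.Empty using (⊥)
open import Data.Product using (Σ; _×_; _,_)
open import Data.Sum using (_⊎_; inj₁; inj₂; [_,_])
open import Data.List using (List; []; _∷_; _++_; map; cartesianProductWith)
open import Data.List.Membership.Propositional using (_∈_)
open import Data.List.Membership.Propositional.Properties
  using (∈-++⁺ˡ; ∈-++⁺ʳ; ∈-++⁻; ∈-map⁺; ∈-map⁻;
         ∈-cartesianProductWith⁺; ∈-cartesianProductWith⁻)
open import Data.List.Relation.Unary.Any using (here; there)
open import Data.List.Relation.Unary.All using (All; []; _∷_; lookup; tabulate)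
import Data.List.Relation.Unary.All.Properties as All
open import Relation.Binary.PropositionalEquality using (_≡_; refl)

infix 2 _⊢ᶜ_
infixl 4 _▸ᶜ_
data _⊢ᶜ_ (Θ : PL → Set) : PL → Set where
  hypᶜ     : ∀ {α} → Θ α → Θ ⊢ᶜ α
  axK      : ∀ α β → Θ ⊢ᶜ α ⇒ (β ⇒ α)
  axS      : ∀ α β γ → Θ ⊢ᶜ (α ⇒ (β ⇒ γ)) ⇒ ((α ⇒ β) ⇒ (α ⇒ γ))
  axContra : ∀ α β → Θ ⊢ᶜ (¬ α ⇒ ¬ β) ⇒ (β ⇒ α)
  mpᶜ      : ∀ {α β} → Θ ⊢ᶜ α → Θ ⊢ᶜ α ⇒ β → Θ ⊢ᶜ β

_▸ᶜ_ : (PL → Set) → PL → (PL → Set)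
(Θ ▸ᶜ α) x = Θ x ⊎ x ≡ α

Taut : PL → Set₁
Taut α = ∀ {Θ} → Θ ⊢ᶜ α

module Classical where

  variable
    Θ : PL → Set
    α β γ : PL

  weakenᶜ : ∀ {Θ Θ'} → (∀ {x} → Θ x → Θ' x) → Θ ⊢ᶜ α → Θ' ⊢ᶜ α
  weakenᶜ f (hypᶜ x)       = hypᶜ (f x)
  weakenᶜ f (axK α β)      = axK α β
  weakenᶜ f (axS α β γ)    = axS α β γ
  weakenᶜ f (axContra α β) = axContra α β
  weakenᶜ f (mpᶜ p q)      = mpᶜ (weakenᶜ f p) (weakenᶜ f q)

  wkᶜ : Θ ⊢ᶜ α → Θ ▸ᶜ β ⊢ᶜ α
  wkᶜ = weakenᶜ inj₁

  wk₁ᶜ : Θ ▸ᶜ α ⊢ᶜ β → Θ ▸ᶜ γ ▸ᶜ α ⊢ᶜ β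
  wk₁ᶜ = weakenᶜ λ { (inj₁ x) → inj₁ (inj₁ x) ; (inj₂ e) → inj₂ e }

  #0ᶜ : Θ ▸ᶜ α ⊢ᶜ α
  #0ᶜ = hypᶜ (inj₂ refl)

  #1ᶜ : Θ ▸ᶜ α ▸ᶜ β ⊢ᶜ α
  #1ᶜ = hypᶜ (inj₁ (inj₂ refl))

  infixl 3 _·ᶜ_
  _·ᶜ_ : Θ ⊢ᶜ α ⇒ β → Θ ⊢ᶜ α → Θ ⊢ᶜ β
  f ·ᶜ a = mpᶜ a f

  idᶜ : ∀ α → Θ ⊢ᶜ α ⇒ α
  idᶜ α = axS α (α ⇒ α) α ·ᶜ axK α (α ⇒ α) ·ᶜ axK α α

  deductionᶜ : Θ ▸ᶜ α ⊢ᶜ β → Θ ⊢ᶜ α ⇒ β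
  deductionᶜ {α = α} (hypᶜ (inj₁ x))   = axK _ α ·ᶜ hypᶜ x
  deductionᶜ {α = α} (hypᶜ (inj₂ refl)) = idᶜ α
  deductionᶜ {α = α} (axK β γ)          = axK _ α ·ᶜ axK β γ
  deductionᶜ {α = α} (axS β γ δ)        = axK _ α ·ᶜ axS β γ δ
  deductionᶜ {α = α} (axContra β γ)     = axK _ α ·ᶜ axContra β γ
  deductionᶜ {α = α} (mpᶜ p q)          = axS α _ _ ·ᶜ deductionᶜ q ·ᶜ deductionᶜ p

  exfalsoᶜ : Θ ⊢ᶜ ¬ α → Θ ⊢ᶜ α → Θ ⊢ᶜ β
  exfalsoᶜ {α = α} {β} n a = axContra β α ·ᶜ (axK (¬ α) (¬ β) ·ᶜ n) ·ᶜ a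

  raaᶜ : Θ ▸ᶜ ¬ α ⊢ᶜ β → Θ ▸ᶜ ¬ α ⊢ᶜ ¬ β → Θ ⊢ᶜ α
  raaᶜ {α = α} p q = axContra α ⊤ᶜ ·ᶜ deductionᶜ (exfalsoᶜ q p) ·ᶜ idᶜ _

  dneᶜ : Θ ⊢ᶜ ¬ ¬ α → Θ ⊢ᶜ α
  dneᶜ p = raaᶜ #0ᶜ (wkᶜ p)

  negIᶜ : Θ ▸ᶜ α ⊢ᶜ β → Θ ▸ᶜ α ⊢ᶜ ¬ β → Θ ⊢ᶜ ¬ α
  negIᶜ p q = raaᶜ (mpᶜ (dneᶜ #0ᶜ) (deductionᶜ (wk₁ᶜ p)))
                   (mpᶜ (dneᶜ #0ᶜ) (deductionᶜ (wk₁ᶜ q)))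

  dniᶜ : Θ ⊢ᶜ α → Θ ⊢ᶜ ¬ ¬ α
  dniᶜ p = negIᶜ (wkᶜ p) #0ᶜ

  ⊤-taut : Taut ⊤ᶜ
  ⊤-taut = idᶜ _

  dne-taut : ∀ β → Taut (¬ ¬ β ⇒ β)
  dne-taut β = deductionᶜ (dneᶜ #0ᶜ)

  explosion-taut : ∀ β → Taut (¬ β ⇒ (β ⇒ ⊥ᶜ))
  explosion-taut β = deductionᶜ (deductionᶜ (exfalsoᶜ #1ᶜ #0ᶜ))

  peirce-taut : ∀ α β → Taut ((¬ ¬ (α ⇒ β) ⇒ α) ⇒ α)
  peirce-taut α β =
    deductionᶜ (raaᶜ (wkᶜ #0ᶜ ·ᶜ dniᶜ (deductionᶜ (exfalsoᶜ #1ᶜ #0ᶜ))) #0ᶜ)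

  ¬⊥-taut : ∀ β → Taut ((¬ ⊥ᶜ ⇒ β) ⇒ β)
  ¬⊥-taut β = deductionᶜ (#0ᶜ ·ᶜ dniᶜ ⊤-taut)

  ∧-elimˡ-taut : ∀ α β → Taut ((α ∧ β) ⇒ α)
  ∧-elimˡ-taut α β = deductionᶜ (raaᶜ (deductionᶜ (exfalsoᶜ (wkᶜ #0ᶜ) #0ᶜ)) (wkᶜ #0ᶜ))

  ∧-elimʳ-taut : ∀ α β → Taut ((α ∧ β) ⇒ β)
  ∧-elimʳ-taut α β = deductionᶜ (raaᶜ (deductionᶜ (wkᶜ #0ᶜ)) (wkᶜ #0ᶜ))

  ∧-intro-taut : ∀ α β → Taut (α ⇒ (β ⇒ (α ∧ β)))
  ∧-intro-taut α β = deductionᶜ (deductionᶜ (negIᶜ (wkᶜ #0ᶜ) (#0ᶜ ·ᶜ wkᶜ #1ᶜ)))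

open Classical using (⊤-taut; dne-taut; explosion-taut; peirce-taut; ¬⊥-taut;
                      ∧-elimˡ-taut; ∧-elimʳ-taut; ∧-intro-taut)

Ctx : Set₁
Ctx = PTL → Set

infixl 4 _▸_
_▸_ : Ctx → PTL → Ctx
(Γ ▸ φ) x = Γ x ⊎ x ≡ φ

variable
  Γ Δ : Ctx
  A B C D X Y Z χ : PTL
  α β γ δ : PL
  βs : List PL

weaken : (∀ {x} → Γ x → Δ x) → Γ ⊢ A → Δ ⊢ A
weaken f (hyp x)     = hyp (f x)
weaken f (C1 a b)    = C1 a b
weaken f (C2 a b c)  = C2 a b c
weaken f (C3 a b)    = C3 a b
weaken f (MPc p q)   = MPc (weaken f p) (weaken f q)
weaken f (M1 a b)    = M1 a b
weaken f (M2 a b c)  = M2 a b c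
weaken f (M3 a b)    = M3 a b
weaken f (M4 a b)    = M4 a b
weaken f (MPm p q)   = MPm (weaken f p) (weaken f q)
weaken f (T1 a b)    = T1 a b
weaken f (L1 a b)    = L1 a b
weaken f (L2 a b c)  = L2 a b c
weaken f (L3 a b c)  = L3 a b c
weaken f (L4 a b)    = L4 a b
weaken f (L5 a b c)  = L5 a b c
weaken f (Nec ψ d)   = Nec ψ d

wk : Γ ⊢ A → (Γ ▸ B) ⊢ A
wk = weaken inj₁

wk₁ : (Γ ▸ A) ⊢ B → (Γ ▸ C ▸ A) ⊢ B
wk₁ = weaken λ { (inj₁ x) → inj₁ (inj₁ x) ; (inj₂ e) → inj₂ e }

#0 : (Γ ▸ A) ⊢ A
#0 = hyp (inj₂ refl)

#1 : (Γ ▸ A ▸ B) ⊢ A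
#1 = hyp (inj₁ (inj₂ refl))

infixl 3 _·_
_·_ : Γ ⊢ (A ↣ B) → Γ ⊢ A → Γ ⊢ B
f · a = MPm a f

embed : (λ _ → ⊥) ⊢ᶜ α → Γ ⊢ cl α
embed (hypᶜ ())
embed (axK a b)      = C1 a b
embed (axS a b c)    = C2 a b c
embed (axContra a b) = C3 a b
embed (mpᶜ p q)      = MPc (embed p) (embed q)

taut : Taut α → Γ ⊢ cl α
taut t = embed t

cl-mp : Taut (α ⇒ β) → Γ ⊢ cl α → Γ ⊢ cl β
cl-mp t p = MPc p (taut t)

cl-mp₂ : Taut (α ⇒ (β ⇒ γ)) → Γ ⊢ cl α → Γ ⊢ cl β → Γ ⊢ cl γ
cl-mp₂ t p q = MPc q (MPc p (taut t))

cl-⊤ : Γ ⊢ cl ⊤ᶜ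
cl-⊤ = taut ⊤-taut

↣-id : ∀ A → Γ ⊢ (A ↣ A)
↣-id A = M2 A (A ↣ A) A · M1 A (A ↣ A) · M1 A A

const : Γ ⊢ B → Γ ⊢ (A ↣ B)
const {A = A} p = M1 _ A · p

-- Classical modus ponens
-- is internalised through axiom M4, and the theorem-only rule Nec needs no
-- care because its conclusions do not depend on premises.
deduction : (Γ ▸ A) ⊢ B → Γ ⊢ (A ↣ B)
deduction (hyp (inj₁ x))            = const (hyp x)
deduction {A = A} (hyp (inj₂ refl)) = ↣-id A
deduction (C1 a b)                  = const (C1 a b)
deduction (C2 a b c)                = const (C2 a b c)
deduction (C3 a b)                  = const (C3 a b)
deduction {A = A} (MPc {α = α} {β} p q) =
  M2 A (cl α) (cl β) · (M2 A (cl (α ⇒ β)) (cl α ↣ cl β) · const (M4 α β) · deduction q)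
    · deduction p
deduction (M1 a b)                  = const (M1 a b)
deduction (M2 a b c)                = const (M2 a b c)
deduction (M3 a b)                  = const (M3 a b)
deduction (M4 a b)                  = const (M4 a b)
deduction {A = A} (MPm p q)         = M2 A _ _ · deduction q · deduction p
deduction (T1 a b)                  = const (T1 a b)
deduction (L1 a b)                  = const (L1 a b)
deduction (L2 a b c)                = const (L2 a b c)
deduction (L3 a b c)                = const (L3 a b c)
deduction (L4 a b)                  = const (L4 a b)
deduction (L5 a b c)                = const (L5 a b c)
deduction (Nec ψ d)                 = const (Nec ψ d)

cut : Γ ⊢ A → (Γ ▸ A) ⊢ B → Γ ⊢ B
cut p q = deduction q · p

exfalso : Γ ⊢ (∼ A) → Γ ⊢ A → Γ ⊢ B
exfalso {A = A} {B = B} n a = M3 B A · (M1 (∼ A) (∼ B) · n) · a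

raa : (Γ ▸ ∼ A) ⊢ B → (Γ ▸ ∼ A) ⊢ (∼ B) → Γ ⊢ A
raa {A = A} p q = M3 A (cl ⊤ᶜ) · deduction (exfalso q p) · cl-⊤

dne : Γ ⊢ (∼ ∼ A) → Γ ⊢ A
dne p = raa #0 (wk p)

negI : (Γ ▸ A) ⊢ B → (Γ ▸ A) ⊢ (∼ B) → Γ ⊢ (∼ A)
negI p q = raa (cut (dne #0) (wk₁ p)) (cut (dne #0) (wk₁ q))

dni : Γ ⊢ A → Γ ⊢ (∼ ∼ A)
dni p = negI (wk p) #0

⊓-intro : Γ ⊢ A → Γ ⊢ B → Γ ⊢ (A ⊓ B)
⊓-intro p q = negI (wk q) (#0 · wk p)

⊓-elimˡ : Γ ⊢ (A ⊓ B) → Γ ⊢ A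
⊓-elimˡ h = raa (deduction (exfalso (wk #0) #0)) (wk h)

⊓-elimʳ : Γ ⊢ (A ⊓ B) → Γ ⊢ B
⊓-elimʳ h = raa (deduction (wk #0)) (wk h)

⊔-introˡ : Γ ⊢ A → Γ ⊢ (A ⊔ B)
⊔-introˡ p = deduction (exfalso #0 (wk p))

⊔-introʳ : Γ ⊢ B → Γ ⊢ (A ⊔ B)
⊔-introʳ q = deduction (wk q)

⊔-elim : Γ ⊢ (A ⊔ B) → (Γ ▸ A) ⊢ C → (Γ ▸ B) ⊢ C → Γ ⊢ C
⊔-elim h f g =
  raa (wk (deduction g) · (wk h · negI (wk (wk (deduction f)) · #0) (wk #0))) #0

infix 1 _⇛_ _≅_
_⇛_ : PTL → PTL → Set₁
A ⇛ B = ∀ {Δ} → Δ ⊢ A → Δ ⊢ B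

record _≅_ (A B : PTL) : Set₁ where
  field
    to   : A ⇛ B
    from : B ⇛ A
open _≅_

≅-refl : A ≅ A
≅-refl = record { to = λ h → h ; from = λ h → h }

infixr 2 _⨾_
_⨾_ : A ≅ B → B ≅ C → A ≅ C
e ⨾ f = record { to = λ h → to f (to e h) ; from = λ h → from e (from f h) }

≅⇒≣ : A ≅ B → A ≣ B
≅⇒≣ e = to e (hyp refl) , from e (hyp refl)

contrapose : A ⇛ B → ∼ B ⇛ ∼ A
contrapose f h = negI (f #0) (wk h)

∼-cong : A ≅ B → ∼ A ≅ ∼ B
∼-cong e = record { to = contrapose (from e) ; from = contrapose (to e) }

⊔-mono : A ⇛ C → B ⇛ D → (A ⊔ B) ⇛ (C ⊔ D)
⊔-mono f g h = ⊔-elim h (⊔-introˡ (f #0)) (⊔-introʳ (g #0))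

⊔-cong : A ≅ C → B ≅ D → (A ⊔ B) ≅ (C ⊔ D)
⊔-cong e f = record { to = ⊔-mono (to e) (to f) ; from = ⊔-mono (from e) (from f) }

⊓-mono : A ⇛ C → B ⇛ D → (A ⊓ B) ⇛ (C ⊓ D)
⊓-mono f g h = ⊓-intro (f (⊓-elimˡ h)) (g (⊓-elimʳ h))

⊓-cong : A ≅ C → B ≅ D → (A ⊓ B) ≅ (C ⊓ D)
⊓-cong e f = record { to = ⊓-mono (to e) (to f) ; from = ⊓-mono (from e) (from f) }

↣≅∼⊔ : (A ↣ B) ≅ ((∼ A) ⊔ B)
↣≅∼⊔ = record { to = λ h → deduction (wk h · dne #0)
               ; from = λ h → deduction (wk h · dni #0) }

-- The algebra of the tensor φ ⊗ ψ = ∼(φ ⊸ ∼ψ).  The rule Nec lifts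
-- uniform entailments under ⊸, which yields monotonicity of ⊸ and ⊗.

theorem : A ⇛ B → Empty ⊢ (A ↣ B)
theorem f = deduction (f #0)

theorem₂ : (∀ {Δ} → Δ ⊢ A → Δ ⊢ B → Δ ⊢ C) → Empty ⊢ (A ↣ (B ↣ C))
theorem₂ f = deduction (deduction (f #1 #0))

⊸-mono : A ⇛ B → Γ ⊢ (X ⊸ A) → Γ ⊢ (X ⊸ B)
⊸-mono {A = A} {B = B} {X = X} f p = L5 X A B · Nec X (theorem f) · p

⊸-mono₂ : (∀ {Δ} → Δ ⊢ A → Δ ⊢ B → Δ ⊢ C) → Γ ⊢ (X ⊸ A) → Γ ⊢ (X ⊸ B) → Γ ⊢ (X ⊸ C)
⊸-mono₂ {A = A} {B = B} {C = C} {X = X} f p q =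
  L5 X B C · (L5 X A (B ↣ C) · Nec X (theorem₂ f) · p) · q

⊸≅∼⊗∼ : (A ⊸ B) ≅ ∼ (A ⊗ (∼ B))
⊸≅∼⊗∼ = record { to = λ h → dni (⊸-mono dni h) ; from = λ h → ⊸-mono dne (dne h) }

⊗-monoʳ : A ⇛ B → (X ⊗ A) ⇛ (X ⊗ B)
⊗-monoʳ f p = negI (⊸-mono (contrapose f) #0) (wk p)

⊗-comm : (X ⊗ Y) ⇛ (Y ⊗ X)
⊗-comm {X = X} {Y = Y} p = negI (L4 Y X · #0) (wk p)

⊗-monoˡ : A ⇛ B → (A ⊗ X) ⇛ (B ⊗ X)
⊗-monoˡ f p = ⊗-comm (⊗-monoʳ f (⊗-comm p))

⊗-mono : A ⇛ C → B ⇛ D → (A ⊗ B) ⇛ (C ⊗ D)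
⊗-mono f g p = ⊗-monoˡ f (⊗-monoʳ g p)

⊗-cong : A ≅ C → B ≅ D → (A ⊗ B) ≅ (C ⊗ D)
⊗-cong e f = record { to = ⊗-mono (to e) (to f) ; from = ⊗-mono (from e) (from f) }

⊗-fillʳ : Γ ⊢ Y → Γ ⊢ (X ⊗ Z) → Γ ⊢ (X ⊗ Y)
⊗-fillʳ {Y = Y} {X = X} {Z = Z} y p =
  negI (L4 Z X · (L2 Y (∼ X) Z · wk y · (L4 X Y · #0))) (wk p)

⊗-assoc : ((X ⊗ Y) ⊗ Z) ⇛ (X ⊗ (Y ⊗ Z))
⊗-assoc {X = X} {Y = Y} {Z = Z} p =
  negI (L4 Z (X ⊗ Y) · ⊸-mono dni (L3 X Z (∼ Y) · ⊸-mono (L4 Y Z ·_) (⊸-mono dne #0)))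
       (wk p)

⊗-assoc⁻ : (X ⊗ (Y ⊗ Z)) ⇛ ((X ⊗ Y) ⊗ Z)
⊗-assoc⁻ p = ⊗-comm (⊗-monoʳ ⊗-comm (⊗-assoc (⊗-monoˡ ⊗-comm (⊗-comm p))))

⊗-distrib : ((A ⊔ B) ⊗ C) ⇛ ((A ⊗ C) ⊔ (B ⊗ C))
⊗-distrib {A = A} {B = B} {C = C} p =
  deduction (negI (L4 C (A ⊔ B) · ⊸-mono₂ (λ a b → negI (#0 · wk a) (wk b))
                                            (L4 A C · dne #1) (L4 B C · #0))
                  (wk (wk p)))

cl-⊗ : (cl α ⊗ cl β) ≅ cl (α ∨ β)
cl-⊗ {α = α} {β = β} =
  record { to = λ p → ⊓-elimˡ (T1 α β) · p ; from = λ p → ⊓-elimʳ (T1 α β) · p }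

-- Negated classical formulas.  `Fails β` (= ∼β) says that β does not hold
-- throughout; `SomeNot β` says that some nonempty part satisfies ¬β.

Fails : PL → PTL
Fails β = ∼ cl β

Inh : PL → PTL
Inh α = cl α ⊓ NE

SomeNot : PL → PTL
SomeNot β = Inh (¬ β) ⊗ cl ⊤ᶜ

SomeNot-S⁺ : ∀ β → S⁺ (SomeNot β)
SomeNot-S⁺ β = s-⊗ (s-⊓ (s-cl (¬ β)) s-ne) (s-cl ⊤ᶜ)

-- Flatness: a tensor factor falsifying δ falsifies δ outright.
fails-⊗ : (Fails δ ⊗ X) ⇛ Fails δ
fails-⊗ {δ = δ} {X = X} p = negI (L4 X (∼ cl δ) · ⊸-mono dni (L1 δ X · #0)) (wk p)

falsum : PTL
falsum = Fails ⊤ᶜ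

falsum-elim : Γ ⊢ falsum → Γ ⊢ A
falsum-elim h = exfalso h cl-⊤

fails-⇒ : Γ ⊢ cl α → Γ ⊢ Fails β → Γ ⊢ Fails (α ⇒ β)
fails-⇒ a n = negI (MPc (wk a) #0) (wk n)

inh¬⇒fails : Inh (¬ β) ⇛ Fails β
inh¬⇒fails {β = β} h =
  negI (cl-mp₂ (explosion-taut β) (wk (⊓-elimˡ h)) #0) (wk (⊓-elimʳ h))

¬-split : Γ ⊢ cl (¬ β) → Γ ⊢ (Inh (¬ β) ⊔ cl ⊥ᶜ)
¬-split h = deduction (raa (⊓-intro (wk (wk h)) #0) (wk #0))

-- Split the team into a ¬β part and a β part; if the ¬β part is empty,
-- β holds throughout, contradicting ∼β.
fails⇒someNot : Fails β ⇛ SomeNot β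
fails⇒someNot {β = β} n =
  ⊔-elim (⊗-distrib (⊗-monoˡ ¬-split (from cl-⊗ (taut (dne-taut β)))))
         (⊗-monoʳ (λ _ → cl-⊤) #0)
         (exfalso (wk n) (cl-mp (¬⊥-taut β) (to cl-⊗ #0)))

fails≅someNot : Fails β ≅ SomeNot β
fails≅someNot = record { to = fails⇒someNot ; from = λ p → fails-⊗ (⊗-monoˡ inh¬⇒fails p) }

-- Basic formulas α ⊓ ∼β₁ ⊓ … ⊓ ∼βₖ, represented by (α , [βₖ, …, β₁]).
-- The negative atoms are rendered by a parameter `neg`: by `Fails` in the
-- normal form, by `SomeNot` in its S⁺ version.

Basic : Set
Basic = PL × List PL

basicWith : (PL → PTL) → Basic → PTL
basicWith neg (α , [])     = cl α
basicWith neg (α , β ∷ βs) = basicWith neg (α , βs) ⊓ neg β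

⟦_⟧ᵇ : Basic → PTL
⟦_⟧ᵇ = basicWith Fails

module _ {neg neg' : PL → PTL} (neg≅neg' : ∀ β → neg β ≅ neg' β) where

  basicWith-cong : ∀ b → basicWith neg b ≅ basicWith neg' b
  basicWith-cong (α , [])     = ≅-refl
  basicWith-cong (α , β ∷ βs) = ⊓-cong (basicWith-cong (α , βs)) (neg≅neg' β)

basicWith-S⁺ : {neg : PL → PTL} → (∀ β → S⁺ (neg β)) → ∀ b → S⁺ (basicWith neg b)
basicWith-S⁺ neg-S⁺ (α , [])     = s-cl α
basicWith-S⁺ neg-S⁺ (α , β ∷ βs) = s-⊓ (basicWith-S⁺ neg-S⁺ (α , βs)) (neg-S⁺ β)

module _ {neg : PL → PTL} where

  basic-intro : Γ ⊢ cl α → All (λ β → Γ ⊢ neg β) βs → Γ ⊢ basicWith neg (α , βs)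
  basic-intro c []       = c
  basic-intro c (n ∷ ns) = ⊓-intro (basic-intro c ns) n

  basic-cl : ∀ βs → Γ ⊢ basicWith neg (α , βs) → Γ ⊢ cl α
  basic-cl []       h = h
  basic-cl (β ∷ βs) h = basic-cl βs (⊓-elimˡ h)

  basic-neg : ∀ βs → Γ ⊢ basicWith neg (α , βs) → All (λ β → Γ ⊢ neg β) βs
  basic-neg []       h = []
  basic-neg (β ∷ βs) h = ⊓-elimʳ h ∷ basic-neg βs (⊓-elimˡ h)

_⊓ᵇ_ : Basic → Basic → Basic
(α , βs) ⊓ᵇ (γ , δs) = (α ∧ γ) , (βs ++ δs)

⊓ᵇ-correct : ∀ b b' → (⟦ b ⟧ᵇ ⊓ ⟦ b' ⟧ᵇ) ≅ ⟦ b ⊓ᵇ b' ⟧ᵇ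
⊓ᵇ-correct (α , βs) (γ , δs) = record { to = conj ; from = split }
  where
  conj : (⟦ α , βs ⟧ᵇ ⊓ ⟦ γ , δs ⟧ᵇ) ⇛ ⟦ α ∧ γ , βs ++ δs ⟧ᵇ
  conj h = basic-intro (cl-mp₂ (∧-intro-taut α γ) (basic-cl βs (⊓-elimˡ h))
                                                  (basic-cl δs (⊓-elimʳ h)))
                       (All.++⁺ (basic-neg βs (⊓-elimˡ h)) (basic-neg δs (⊓-elimʳ h)))

  split : ⟦ α ∧ γ , βs ++ δs ⟧ᵇ ⇛ (⟦ α , βs ⟧ᵇ ⊓ ⟦ γ , δs ⟧ᵇ)
  split {Δ} h = ⊓-intro (basic-intro (cl-mp (∧-elimˡ-taut α γ) c) (All.++⁻ˡ βs ns))
                        (basic-intro (cl-mp (∧-elimʳ-taut α γ) c) (All.++⁻ʳ βs ns))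
    where
    c : Δ ⊢ cl (α ∧ γ)
    c = basic-cl (βs ++ δs) h
    ns : All (λ β → Δ ⊢ Fails β) (βs ++ δs)
    ns = basic-neg (βs ++ δs) h

-- Tensor of basic formulas: the classical parts are joined by ∨ (axiom
-- T1), and each atom ∼β of a factor with classical part α survives as
-- ∼(α ⇒ β).
_⊗ᵇ_ : Basic → Basic → Basic
(α , βs) ⊗ᵇ (γ , δs) = (α ∨ γ) , (map (α ⇒_) βs ++ map (γ ⇒_) δs)

factor-fails : β ∈ βs → (⟦ α , βs ⟧ᵇ ⊗ X) ⇛ Fails (α ⇒ β)
factor-fails {βs = βs} m p =
  fails-⊗ (⊗-monoˡ (λ h → fails-⇒ (basic-cl βs h) (lookup (basic-neg βs h) m)) p)

⊗ᵇ-to : ∀ b b' → (⟦ b ⟧ᵇ ⊗ ⟦ b' ⟧ᵇ) ⇛ ⟦ b ⊗ᵇ b' ⟧ᵇ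
⊗ᵇ-to (α , βs) (γ , δs) p =
  basic-intro (to cl-⊗ (⊗-mono (basic-cl βs) (basic-cl δs) p))
              (All.++⁺ (All.map⁺ (tabulate λ m → factor-fails m p))
                       (All.map⁺ (tabulate λ m → factor-fails m (⊗-comm p))))

-- Conversely, a nonempty ¬(α ⇒ β) part (that is, α ∧ ¬β) can be absorbed
-- into a factor with classical part α, adding the atom ∼β to it.
absorb : ∀ βs → (Inh (¬ (α ⇒ β)) ⊗ ⟦ α , βs ⟧ᵇ) ⇛ ⟦ α , β ∷ βs ⟧ᵇ
absorb {α = α} {β = β} βs h =
  ⊓-intro (basic-intro (cl-mp (peirce-taut α β) (to cl-⊗ (⊗-mono ⊓-elimˡ (basic-cl βs) h)))
                       (tabulate λ m →
                          fails-⊗ (⊗-monoˡ (λ x → lookup (basic-neg βs x) m) (⊗-comm h))))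
          (fails-⊗ (⊗-monoˡ (λ x → negI (MPc #0 (C1 β α)) (wk (inh¬⇒fails x))) h))

-- Given ∼(α ⇒ β), split off such a part (fails≅someNot) and absorb it.
extend : Γ ⊢ (⟦ α , βs ⟧ᵇ ⊗ Y) → Γ ⊢ Fails (α ⇒ β) → Γ ⊢ (⟦ α , β ∷ βs ⟧ᵇ ⊗ Y)
extend {βs = βs} p n = ⊗-monoˡ (absorb βs) (⊗-assoc⁻ (⊗-fillʳ p (fails⇒someNot n)))

extend* : All (λ β → Γ ⊢ Fails (α ⇒ β)) βs → Γ ⊢ (cl α ⊗ Y) → Γ ⊢ (⟦ α , βs ⟧ᵇ ⊗ Y)
extend* []       p = p
extend* (n ∷ ns) p = extend (extend* ns p) n

⊗ᵇ-from : ∀ b b' → ⟦ b ⊗ᵇ b' ⟧ᵇ ⇛ (⟦ b ⟧ᵇ ⊗ ⟦ b' ⟧ᵇ)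
⊗ᵇ-from (α , βs) (γ , δs) {Δ} t =
  ⊗-comm (extend* (All.map⁻ (All.++⁻ʳ (map (α ⇒_) βs) ns))
           (⊗-comm (extend* (All.map⁻ (All.++⁻ˡ (map (α ⇒_) βs) ns))
                     (from cl-⊗ (basic-cl atoms t)))))
  where
  atoms : List PL
  atoms = map (α ⇒_) βs ++ map (γ ⇒_) δs
  ns : All (λ β → Δ ⊢ Fails β) atoms
  ns = basic-neg atoms t

⊗ᵇ-correct : ∀ b b' → (⟦ b ⟧ᵇ ⊗ ⟦ b' ⟧ᵇ) ≅ ⟦ b ⊗ᵇ b' ⟧ᵇ
⊗ᵇ-correct b b' = record { to = ⊗ᵇ-to b b' ; from = ⊗ᵇ-from b b' }

DNF : Set
DNF = List Basic

dnfWith : (PL → PTL) → DNF → PTL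
dnfWith neg []      = neg ⊤ᶜ
dnfWith neg (b ∷ D) = basicWith neg b ⊔ dnfWith neg D

⟦_⟧ : DNF → PTL
⟦_⟧ = dnfWith Fails

module _ {neg neg' : PL → PTL} (neg≅neg' : ∀ β → neg β ≅ neg' β) where

  dnfWith-cong : ∀ D → dnfWith neg D ≅ dnfWith neg' D
  dnfWith-cong []      = neg≅neg' ⊤ᶜ
  dnfWith-cong (b ∷ D) = ⊔-cong (basicWith-cong neg≅neg' b) (dnfWith-cong D)

dnfWith-S⁺ : {neg : PL → PTL} → (∀ β → S⁺ (neg β)) → ∀ D → S⁺ (dnfWith neg D)
dnfWith-S⁺ neg-S⁺ []      = neg-S⁺ ⊤ᶜ
dnfWith-S⁺ neg-S⁺ (b ∷ D) = s-⊔ (basicWith-S⁺ neg-S⁺ b) (dnfWith-S⁺ neg-S⁺ D)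

dnf-intro : ∀ {b} D → b ∈ D → Γ ⊢ ⟦ b ⟧ᵇ → Γ ⊢ ⟦ D ⟧
dnf-intro (_ ∷ D) (here refl) h = ⊔-introˡ h
dnf-intro (_ ∷ D) (there m)   h = ⊔-introʳ (dnf-intro D m h)

dnf-elim : ∀ D → Γ ⊢ ⟦ D ⟧ → (∀ {b} → b ∈ D → (Γ ▸ ⟦ b ⟧ᵇ) ⊢ χ) → Γ ⊢ χ
dnf-elim []      h f = falsum-elim h
dnf-elim (b ∷ D) h f = ⊔-elim h (f (here refl)) (dnf-elim D #0 (λ m → wk₁ (f (there m))))

∨ᵈ-correct : ∀ D D' → (⟦ D ⟧ ⊔ ⟦ D' ⟧) ≅ ⟦ D ++ D' ⟧
∨ᵈ-correct D D' = record
  { to   = λ h → ⊔-elim h (dnf-elim D #0 λ m → dnf-intro (D ++ D') (∈-++⁺ˡ m) #0)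
                          (dnf-elim D' #0 λ m → dnf-intro (D ++ D') (∈-++⁺ʳ D m) #0)
  ; from = λ h → dnf-elim (D ++ D') h λ m →
             [ (λ m₁ → ⊔-introˡ (dnf-intro D m₁ #0))
             , (λ m₂ → ⊔-introʳ (dnf-intro D' m₂ #0)) ]
               (∈-++⁻ D m)
  }

-- A binary connective that is monotone, commutative, distributes over ⊔
-- and annihilates the contradiction lifts from basic formulas to DNFs by
-- the distributive law (product-correct).
record Distributive (_∘_ : PTL → PTL → PTL) : Set₁ where
  field
    mono    : A ⇛ C → B ⇛ D → (A ∘ B) ⇛ (C ∘ D)
    comm    : (A ∘ B) ⇛ (B ∘ A)
    distrib : ((A ⊔ B) ∘ C) ⇛ ((A ∘ C) ⊔ (B ∘ C))
    annihil : (falsum ∘ A) ⇛ falsum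

module Product {_∘_ : PTL → PTL → PTL} (dist : Distributive _∘_)
               (_∘ᵇ_ : Basic → Basic → Basic)
               (∘ᵇ-correct : ∀ b b' → (⟦ b ⟧ᵇ ∘ ⟦ b' ⟧ᵇ) ≅ ⟦ b ∘ᵇ b' ⟧ᵇ) where
  open Distributive dist

  cases : ∀ D → Γ ⊢ (⟦ D ⟧ ∘ X) → (∀ {b} → b ∈ D → (Γ ▸ (⟦ b ⟧ᵇ ∘ X)) ⊢ χ) → Γ ⊢ χ
  cases []      h f = falsum-elim (annihil h)
  cases (b ∷ D) h f = ⊔-elim (distrib h) (f (here refl)) (cases D #0 (λ m → wk₁ (f (there m))))

  product-correct : ∀ D D' → (⟦ D ⟧ ∘ ⟦ D' ⟧) ≅ ⟦ cartesianProductWith _∘ᵇ_ D D' ⟧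
  product-correct D D' = record
    { to   = λ h → cases D h λ {b} m → cases D' (comm #0) λ {b'} m' →
               dnf-intro DD' (∈-cartesianProductWith⁺ _∘ᵇ_ m m') (to (∘ᵇ-correct b b') (comm #0))
    ; from = λ h → dnf-elim DD' h pair
    }
    where
    DD' : DNF
    DD' = cartesianProductWith _∘ᵇ_ D D'
    pair : ∀ {Δ b} → b ∈ DD' → (Δ ▸ ⟦ b ⟧ᵇ) ⊢ (⟦ D ⟧ ∘ ⟦ D' ⟧)
    pair m with ∈-cartesianProductWith⁻ _∘ᵇ_ D D' m
    ... | b , b' , m , m' , refl =
      mono (dnf-intro D m) (dnf-intro D' m') (from (∘ᵇ-correct b b') #0)

⊓-distributive : Distributive _⊓_
⊓-distributive = record
  { mono    = ⊓-mono
  ; comm    = λ h → ⊓-intro (⊓-elimʳ h) (⊓-elimˡ h)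
  ; distrib = λ h → ⊔-elim (⊓-elimˡ h) (⊔-introˡ (⊓-intro #0 (wk (⊓-elimʳ h))))
                                       (⊔-introʳ (⊓-intro #0 (wk (⊓-elimʳ h))))
  ; annihil = ⊓-elimˡ
  }

⊗-distributive : Distributive _⊗_
⊗-distributive = record
  { mono = ⊗-mono ; comm = ⊗-comm ; distrib = ⊗-distrib ; annihil = fails-⊗ }

_∧ᵈ_ : DNF → DNF → DNF
_∧ᵈ_ = cartesianProductWith _⊓ᵇ_

∧ᵈ-correct : ∀ D D' → (⟦ D ⟧ ⊓ ⟦ D' ⟧) ≅ ⟦ D ∧ᵈ D' ⟧
∧ᵈ-correct = Product.product-correct ⊓-distributive _⊓ᵇ_ ⊓ᵇ-correct

_⊗ᵈ_ : DNF → DNF → DNF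
_⊗ᵈ_ = cartesianProductWith _⊗ᵇ_

⊗ᵈ-correct : ∀ D D' → (⟦ D ⟧ ⊗ ⟦ D' ⟧) ≅ ⟦ D ⊗ᵈ D' ⟧
⊗ᵈ-correct = Product.product-correct ⊗-distributive _⊗ᵇ_ ⊗ᵇ-correct

∼ᵇ : Basic → DNF
∼ᵇ (α , βs) = (⊤ᶜ , α ∷ []) ∷ map (_, []) βs

∼ᵇ-correct : ∀ b → ∼ ⟦ b ⟧ᵇ ≅ ⟦ ∼ᵇ b ⟧
∼ᵇ-correct (α , βs) = record
  { to   = λ h → raa (basic-intro (raa (dnf-intro N (here refl) (⊓-intro cl-⊤ #0)) (wk #0))
                                  (tabulate λ m → negI (dnf-intro N (there (∈-map⁺ (_, []) m)) #0)
                                                       (wk #0)))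
                     (wk h)
  ; from = λ h → dnf-elim N h refute
  }
  where
  N : DNF
  N = ∼ᵇ (α , βs)
  refute : ∀ {Δ b} → b ∈ N → (Δ ▸ ⟦ b ⟧ᵇ) ⊢ (∼ ⟦ α , βs ⟧ᵇ)
  refute (here refl) = negI (basic-cl βs #0) (wk (⊓-elimʳ #0))
  refute (there m) with ∈-map⁻ (_, []) m
  ... | β , mβ , refl = negI (wk #0) (lookup (basic-neg βs #0) mβ)

∼⊔≅⊓∼ : ∼ (A ⊔ B) ≅ ((∼ A) ⊓ (∼ B))
∼⊔≅⊓∼ = record
  { to   = λ h → ⊓-intro (contrapose ⊔-introˡ h) (contrapose ⊔-introʳ h)
  ; from = λ h → negI (#0 · wk (⊓-elimˡ h)) (wk (⊓-elimʳ h))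
  }

∼ᵈ : DNF → DNF
∼ᵈ []      = (⊤ᶜ , []) ∷ []
∼ᵈ (b ∷ D) = ∼ᵇ b ∧ᵈ ∼ᵈ D

∼ᵈ-correct : ∀ D → ∼ ⟦ D ⟧ ≅ ⟦ ∼ᵈ D ⟧
∼ᵈ-correct []      = record { to = λ _ → ⊔-introˡ cl-⊤ ; from = λ _ → dni cl-⊤ }
∼ᵈ-correct (b ∷ D) = ∼⊔≅⊓∼ ⨾ ⊓-cong (∼ᵇ-correct b) (∼ᵈ-correct D) ⨾ ∧ᵈ-correct (∼ᵇ b) (∼ᵈ D)

-- The normal form of a PTL formula, using φ ↣ ψ ≅ ∼φ ⊔ ψ and
-- φ ⊸ ψ ≅ ∼(φ ⊗ ∼ψ).
nf : PTL → DNF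
nf (cl α)  = (α , []) ∷ []
nf (∼ φ)   = ∼ᵈ (nf φ)
nf (φ ↣ ψ) = ∼ᵈ (nf φ) ++ nf ψ
nf (φ ⊸ ψ) = ∼ᵈ (nf φ ⊗ᵈ ∼ᵈ (nf ψ))

nf-correct  : ∀ φ → φ ≅ ⟦ nf φ ⟧
∼nf-correct : ∀ φ → ∼ φ ≅ ⟦ ∼ᵈ (nf φ) ⟧

nf-correct (cl α)  = record { to = ⊔-introˡ ; from = λ h → ⊔-elim h #0 (falsum-elim #0) }
nf-correct (∼ φ)   = ∼nf-correct φ
nf-correct (φ ↣ ψ) =
  ↣≅∼⊔ ⨾ ⊔-cong (∼nf-correct φ) (nf-correct ψ) ⨾ ∨ᵈ-correct (∼ᵈ (nf φ)) (nf ψ)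
nf-correct (φ ⊸ ψ) =
  ⊸≅∼⊗∼ ⨾ ∼-cong (⊗-cong (nf-correct φ) (∼nf-correct ψ) ⨾ ⊗ᵈ-correct (nf φ) (∼ᵈ (nf ψ)))
        ⨾ ∼ᵈ-correct (nf φ ⊗ᵈ ∼ᵈ (nf ψ))

∼nf-correct φ = ∼-cong (nf-correct φ) ⨾ ∼ᵈ-correct (nf φ)

-- Corollary 4.5: rendering the atoms of the normal form by SomeNot instead
-- of Fails gives an equivalent formula of S⁺(PL ∪ {NE}).
corollary45 : (φ : PTL) → Σ PTL (λ ψ → S⁺ ψ × (φ ≣ ψ))
corollary45 φ =
  dnfWith SomeNot (nf φ) ,
  dnfWith-S⁺ SomeNot-S⁺ (nf φ) ,
  ≅⇒≣ (nf-correct φ ⨾ dnfWith-cong (λ _ → fails≅someNot) (nf φ))
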